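{- Let $p$ be a prime, $\alpha\geqslant1$, and $X\subseteq\mathbb{Z}_{p^\alpha}$ satisfy: $0\notin X$, $X\neq-X$, and there is a positive integer $m$ with $(\mathcal{F}\Delta_{X\uplus(-X)})(z)\in\{0,-m\}$ for all $0\neq z\in\mathbb{Z}_{p^\alpha}$. Then there are integers $1\leqslant r_1<r_2<\cdots<r_s\leqslant\alpha$ and $1\leqslant r_{s+1}<r_{s+2}<\cdots<r_t\leqslant\alpha$ such that $$U_X=(2\otimes O_{r_1})\uplus\cdots\uplus(2\otimes O_{r_s})\uplus(O_{r_{s+1}}\cup O_{r_{s+2}}\cup\cdots\cup O_{r_t}),$$ where $U_X=X\uplus(-X)$.
   Context: For a multiset $A$ of $\mathbb{Z}_n$ with multiplicity function $\Delta_A$, $(\mathcal{F}\Delta_A)(z)=\sum_{i\in\mathbb{Z}_n}\Delta_A(i)\zeta_n^{iz}$ with $\zeta_n$ a fixed primitive $n$-th root of unity. $\uplus$ is multiset union (multiplicities add), $2\otimes A$ is the multiset with all multiplicities of $A$ doubled, $-X=\{ -x:x\in X\}$. For $0\leqslant i\leqslant\alpha$, $O_i$ is the set of elements of $\mathbb{Z}_{p^\alpha}$ of additive order $p^i$ (the $\mathbb{Z}_{p^\alpha}^\ast$-orbits). -}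

module Defs where

open import Data.Bool using (Bool; true; false; if_then_else_; _∨_)
open import Data.Nat using (ℕ; zero; suc; _+_; _*_; _∸_; _^_)
open import Data.Nat.DivMod using (_mod_)
open import Data.Nat.Divisibility using (_∣?_)
open import Data.Fin using (Fin; toℕ)
open import Data.List using (List; []; _∷_; foldr; map; allFin)
open import Data.Integer using (ℤ; +_; _-_)
import Data.Integer as ℤ
open import Data.Product using (∃)
open import Relation.Binary.PropositionalEquality using (_≡_)
open import Relation.Nullary.Decidable using (⌊_⌋)
import Data.Fin as F
import Data.Nat as N

negZ : ∀ {n} → Fin n → Fin n
negZ {suc k} x = (suc k ∸ toℕ x) mod suc k

subZ : ∀ {n} → Fin n → Fin n → Fin n
subZ {suc k} x y = (toℕ x + (suc k ∸ toℕ y)) mod suc k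

mulZ : ∀ {n} → Fin n → Fin n → Fin n
mulZ {suc k} x y = (toℕ x * toℕ y) mod suc k

-- first k in [start, start + fuel) satisfying P (0 if none)
firstFrom : ℕ → ℕ → (ℕ → Bool) → ℕ
firstFrom zero    start P = 0
firstFrom (suc f) start P = if P start then start else firstFrom f (suc start) P

ord : ∀ {n} → Fin n → ℕ
ord {n} x = firstFrom n 1 (λ k → ⌊ n ∣? (k * toℕ x) ⌋)

SetZ : ℕ → Set
SetZ n = Fin n → Bool

Multiset : ℕ → Set
Multiset n = Fin n → ℕ

Δ : ∀ {n} → SetZ n → Multiset n
Δ A i = if A i then 1 else 0

negSet : ∀ {n} → SetZ n → SetZ n
negSet A i = A (negZ i)

_⊎ₘ_ : ∀ {n} → Multiset n → Multiset n → Multiset n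
(A ⊎ₘ B) i = A i + B i

2⊗_ : ∀ {n} → Multiset n → Multiset n
(2⊗ A) i = 2 * A i

⨄ : ∀ {n} → List (Multiset n) → Multiset n
⨄ = foldr _⊎ₘ_ (λ _ → 0)

⋃ : ∀ {n} → List (SetZ n) → SetZ n
⋃ = foldr (λ A B i → A i ∨ B i) (λ _ → false)

U : ∀ {n} → SetZ n → Multiset n
U X = Δ X ⊎ₘ Δ (negSet X)

O : (p α i : ℕ) → SetZ (p ^ α)
O p α i x = ⌊ ord x N.≟ p ^ i ⌋

-- Fourier transform, with values in ℤ[ζ_n] modelled as ℤ[x]/(Φ_n(x)).
-- An element of the group ring ℤ[x]/(x^n - 1) is a coefficient function.

GR : ℕ → Set
GR n = Fin n → ℤ

sumℤ : ∀ {n} → (Fin n → ℤ) → ℤ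
sumℤ {n} f = foldr (λ i acc → f i ℤ.+ acc) (+ 0) (allFin n)

-- cyclic convolution = product in ℤ[x]/(x^n - 1)
conv : ∀ {n} → GR n → GR n → GR n
conv g h k = sumℤ (λ j → g j ℤ.* h (subZ k j))

-- Φ_{p^α}(x) = Σ_{j<p} x^{j p^{α-1}}  (the p^α-th cyclotomic polynomial)
Φ : (p α : ℕ) → GR (p ^ α)
Φ p α k = if ⌊ (p ^ (α ∸ 1)) ∣? toℕ k ⌋ then + 1 else + 0

-- (F Δ_A)(z) = Σ_i Δ_A(i) ζ^{iz}, as the group ring element Σ_i Δ_A(i) x^{iz mod n}
F : ∀ {n} → Multiset n → Fin n → GR n
F A z k = sumℤ (λ i → if ⌊ mulZ i z F.≟ k ⌋ then + A i else + 0)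

-- "f(ζ) = c" for f ∈ ℤ[x]/(x^n-1), n = p^α, c ∈ ℤ:
-- f - c is divisible by Φ_{p^α} (i.e. f - c ≡ g·Φ mod x^n - 1)
EvalEq : (p α : ℕ) → GR (p ^ α) → ℤ → Set
EvalEq p α f c =
  ∃ λ (g : GR (p ^ α)) → ∀ k →
    f k - (if ⌊ toℕ k N.≟ 0 ⌋ then c else + 0) ≡ conv g (Φ p α) k

-- A polynomial g ∈ ℤ[x]/(xⁿ − 1), n = p ^ α, takes an integer value c at a primitive n-th root of
-- unity iff g − c is a multiple of Φ(x) = Σ_{j<p} x^(j p^(α−1)); every multiple of Φ is periodic
-- mod p ^ (α − 1), so away from its constant term the coefficient vector of g is as well.
-- For z = p ^ j the coefficient of x^(r p^j) in (FΔ)(z) is the total multiplicity of the class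
-- r mod p ^ (α − j), a class of p ^ j elements. Descending induction on m, comparing two such
-- coefficients by periodicity, shows that the multiplicity is constant on the elements ≡ x (mod p ^ m)
-- that are not divisible by p ^ (m + 1), hence on each orbit O_(α − m). As U_X has multiplicities
-- in {0, 1, 2} and vanishes at 0, it is the union of the 2 ⊗ O_r of multiplicity 2 and the O_r of
-- multiplicity 1.

module Submission where

open import Defs
open import Data.Bool using (Bool; true; false; if_then_else_; T; _∨_)
open import Data.Bool.Properties using (T?; ∨-zeroʳ)
open import Data.Fin using (Fin; toℕ; fromℕ<)
open import Data.Fin.Properties using (toℕ-fromℕ<; toℕ-injective; toℕ<n)
import Data.Fin as Fin
open import Data.Integer using (ℤ; +_; -_; _-_) renaming (_+_ to _+ℤ_; _*_ to _*ℤ_)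
import Data.Integer.Properties as ℤ
open import Data.List using (List; []; _∷_; foldr; map; tabulate; allFin; applyUpTo; filterᵇ)
open import Data.List.Properties using (foldr-cong)
open import Data.List.Membership.Propositional using (_∈_; _∉_)
open import Data.List.Membership.Propositional.Properties using (∈-filter⁺; ∈-filter⁻; ∈-applyUpTo⁺)
open import Data.List.Relation.Unary.All using (All)
import Data.List.Relation.Unary.All as All
import Data.List.Relation.Unary.All.Properties as All
open import Data.List.Relation.Unary.AllPairs using (_∷_)
import Data.List.Relation.Unary.AllPairs as AllPairs
open import Data.List.Relation.Unary.Any using (here; there)
open import Data.List.Relation.Unary.Linked using (Linked)
import Data.List.Relation.Unary.Linked.Properties as Linked
open import Data.List.Relation.Unary.Unique.Propositional using (Unique)
import Data.List.Relation.Unary.Unique.Propositional.Properties as Unique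
open import Data.Nat
  using (ℕ; zero; suc; _+_; _*_; _∸_; _^_; _≤_; _<_; z≤n; s≤s; _%_; _≟_; _≡ᵇ_;
         NonZero; >-nonZero; ≢-nonZero⁻¹; nonTrivial⇒n>1)
open import Data.Nat.DivMod
open import Data.Nat.Divisibility
open import Data.Nat.Primality using (Prime; euclidsLemma; prime⇒nonZero; prime⇒nonTrivial)
open import Data.Nat.Properties
open import Algebra.Properties.CommutativeSemigroup *-commutativeSemigroup using (xy∙z≈zx∙y; xy∙z≈y∙xz; x∙yz≈y∙xz)
open import Data.Product using (∃; ∃₂; _,_; _×_; proj₁; proj₂)
open import Data.Sum using (_⊎_; inj₁; inj₂; [_,_]′)
open import Data.Unit using (tt)
open import Function using (_∘_; id; _⇔_; mk⇔)
open import Relation.Binary.Definitions using (tri<; tri≈; tri>)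
open import Relation.Binary.PropositionalEquality
open import Relation.Nullary using (Dec; yes; no; ¬_; contradiction)
open import Relation.Nullary.Decidable using (⌊_⌋; isYes≗does; dec-true; dec-false; does-⇔)

⌊⌋-⇔ : {A B : Set} → A ⇔ B → (a? : Dec A) (b? : Dec B) → ⌊ a? ⌋ ≡ ⌊ b? ⌋
⌊⌋-⇔ A⇔B a? b? = trans (isYes≗does a?) (trans (does-⇔ A⇔B a? b?) (sym (isYes≗does b?)))

⌊⌋-true : {A : Set} (a? : Dec A) → A → ⌊ a? ⌋ ≡ true
⌊⌋-true a? a = trans (isYes≗does a?) (dec-true a? a)

⌊⌋-false : {A : Set} (a? : Dec A) → ¬ A → ⌊ a? ⌋ ≡ false
⌊⌋-false a? ¬a = trans (isYes≗does a?) (dec-false a? ¬a)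

sumUpTo : ℕ → (ℕ → ℤ) → ℤ
sumUpTo zero    h = + 0
sumUpTo (suc n) h = h 0 +ℤ sumUpTo n (h ∘ suc)

sumℤ-cong : ∀ {n} {f g : Fin n → ℤ} → (∀ i → f i ≡ g i) → sumℤ f ≡ sumℤ g
sumℤ-cong {n} f≗g = foldr-cong (λ i acc → cong (_+ℤ acc) (f≗g i)) refl (allFin n)

sumℤ≡sumUpTo : ∀ {n} {f : Fin n → ℤ} {h : ℕ → ℤ} → (∀ i → f i ≡ h (toℕ i)) →
  sumℤ f ≡ sumUpTo n h
sumℤ≡sumUpTo {n} {f} = tabulated n id
  where
  tabulated : ∀ k (g : Fin k → Fin n) {h : ℕ → ℤ} → (∀ i → f (g i) ≡ h (toℕ i)) →
       foldr (λ i acc → f i +ℤ acc) (+ 0) (tabulate g) ≡ sumUpTo k h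
  tabulated zero    g f∘g≗h = refl
  tabulated (suc k) g f∘g≗h = cong₂ _+ℤ_ (f∘g≗h Fin.zero) (tabulated k (g ∘ Fin.suc) (f∘g≗h ∘ Fin.suc))

sumUpTo-cong : ∀ n {h g : ℕ → ℤ} → (∀ {t} → t < n → h t ≡ g t) → sumUpTo n h ≡ sumUpTo n g
sumUpTo-cong zero    h≗g = refl
sumUpTo-cong (suc n) h≗g = cong₂ _+ℤ_ (h≗g (s≤s z≤n)) (sumUpTo-cong n (h≗g ∘ s≤s))

sumUpTo-+ : ∀ m n (h : ℕ → ℤ) → sumUpTo (m + n) h ≡ sumUpTo m h +ℤ sumUpTo n (λ t → h (m + t))
sumUpTo-+ zero    n h = sym (ℤ.+-identityˡ _)
sumUpTo-+ (suc m) n h = trans (cong (h 0 +ℤ_) (sumUpTo-+ m n (h ∘ suc))) (sym (ℤ.+-assoc (h 0) _ _))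

sumUpTo-indicator : ∀ n {r} v → r < n → sumUpTo n (λ t → if ⌊ t ≟ r ⌋ then + v else + 0) ≡ + v
sumUpTo-indicator (suc n) {zero} v _ =
  trans (cong (+ v +ℤ_) (zeros n)) (ℤ.+-identityʳ _)
  where
  zeros : ∀ n → sumUpTo n (λ _ → + 0) ≡ + 0
  zeros zero    = refl
  zeros (suc n) = trans (ℤ.+-identityˡ _) (zeros n)
sumUpTo-indicator (suc n) {suc r} v (s≤s r<n) =
  trans (ℤ.+-identityˡ _) (trans (sumUpTo-cong n shift) (sumUpTo-indicator n v r<n))
  where
  shift : ∀ {t} → t < n → (if ⌊ suc t ≟ suc r ⌋ then + v else + 0) ≡ (if ⌊ t ≟ r ⌋ then + v else + 0)
  shift {t} _ = cong (λ b → if b then + v else + 0) (⌊⌋-⇔ (mk⇔ suc-injective (cong suc)) _ _)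

sumUpTo-residue-indicator : ∀ c M .{{_ : NonZero M}} {r} v → r < M →
  sumUpTo (c * M) (λ t → if ⌊ t % M ≟ r ⌋ then + v else + 0) ≡ + (c * v)
sumUpTo-residue-indicator zero    M v _   = refl
sumUpTo-residue-indicator (suc c) M {r} v r<M = begin
  sumUpTo (M + c * M) h                                ≡⟨ sumUpTo-+ M (c * M) h ⟩
  sumUpTo M h +ℤ sumUpTo (c * M) (λ t → h (M + t))     ≡⟨ cong₂ _+ℤ_ first-period later-periods ⟩
  + v +ℤ + (c * v)                                     ∎
  where
  open ≡-Reasoning
  h : ℕ → ℤ
  h t = if ⌊ t % M ≟ r ⌋ then + v else + 0
  first-period : sumUpTo M h ≡ + v
  first-period = trans (sumUpTo-cong M (λ t<M → cong (λ w → if ⌊ w ≟ r ⌋ then + v else + 0) (m<n⇒m%n≡m t<M)))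
                       (sumUpTo-indicator M v r<M)
  later-periods : sumUpTo (c * M) (λ t → h (M + t)) ≡ + (c * v)
  later-periods = trans (sumUpTo-cong (c * M) (λ {t} _ → cong (λ w → if ⌊ w ≟ r ⌋ then + v else + 0)
                                                          (trans (cong (_% M) (+-comm M t)) ([m+n]%n≡m%n t M))))
                        (sumUpTo-residue-indicator c M v r<M)

toℕ-mulZ : ∀ {n} .{{_ : NonZero n}} (x y : Fin n) → toℕ (mulZ x y) ≡ toℕ x * toℕ y % n
toℕ-mulZ {suc _} x y = toℕ-fromℕ< _

toℕ-subZ : ∀ {n} .{{_ : NonZero n}} (x y : Fin n) → toℕ (subZ x y) ≡ (toℕ x + (n ∸ toℕ y)) % n
toℕ-subZ {suc _} x y = toℕ-fromℕ< _

toℕ-negZ : ∀ {n} .{{_ : NonZero n}} (x : Fin n) → toℕ (negZ x) ≡ (n ∸ toℕ x) % n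
toℕ-negZ {suc _} x = toℕ-fromℕ< _

%-≡⇒∣⇒∣ : ∀ {m n d} .{{_ : NonZero d}} → m % d ≡ n % d → d ∣ m → d ∣ n
%-≡⇒∣⇒∣ {m} {n} {d} m≡n d∣m = m%n≡0⇒n∣m n d (trans (sym m≡n) (n∣m⇒m%n≡0 m d d∣m))

%-scaled : ∀ t c M P .{{_ : NonZero M}} .{{_ : NonZero (c * M)}} .{{_ : NonZero (M * P)}} →
  t % (c * M) * P % (M * P) ≡ t % M * P
%-scaled t c M P = trans (sym (m%n*o≡m*o%[n*o] (t % (c * M)) M P)) (cong (_* P) (m∣n⇒o%n%m≡o%m M (c * M) t (n∣m*n c)))

-- As n = M P, the exponent i z = i P mod n only depends on i mod M.
F-coeff-on-class : ∀ {n} M P .{{_ : NonZero M}} .{{_ : NonZero P}} → n ≡ M * P →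
  (f : Multiset n) {z k : Fin n} → toℕ z ≡ P → ∀ {r} → r < M → toℕ k ≡ r * P →
  ∀ {v} → (∀ i → toℕ i % M ≡ r → f i ≡ v) → F f z k ≡ + (P * v)
F-coeff-on-class {n} M P n≡MP f {z} {k} z≡P {r} r<M k≡rP {v} f≡v = begin
  F f z k            ≡⟨ sumℤ≡sumUpTo term ⟩
  sumUpTo n h        ≡⟨ cong (λ w → sumUpTo w h) (trans n≡MP (*-comm M P)) ⟩
  sumUpTo (P * M) h  ≡⟨ sumUpTo-residue-indicator P M v r<M ⟩
  + (P * v)          ∎
  where
  open ≡-Reasoning
  instance
    MP≢0 : NonZero (M * P)
    MP≢0 = m*n≢0 M P
    n≢0 : NonZero n
    n≢0 = subst NonZero (sym n≡MP) MP≢0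
  h : ℕ → ℤ
  h t = if ⌊ t % M ≟ r ⌋ then + v else + 0
  iz≡ : ∀ i → toℕ (mulZ i z) ≡ toℕ i % M * P
  iz≡ i = begin
    toℕ (mulZ i z)         ≡⟨ toℕ-mulZ i z ⟩
    toℕ i * toℕ z % n      ≡⟨ cong (λ w → toℕ i * w % n) z≡P ⟩
    toℕ i * P % n          ≡⟨ %-congʳ n≡MP ⟩
    toℕ i * P % (M * P)    ≡⟨ sym (m%n*o≡m*o%[n*o] (toℕ i) M P) ⟩
    toℕ i % M * P          ∎
  hit : ∀ i → mulZ i z ≡ k ⇔ toℕ i % M ≡ r
  hit i = mk⇔ (λ iz≡k → *-cancelʳ-≡ _ _ P (trans (sym (iz≡ i)) (trans (cong toℕ iz≡k) k≡rP)))
              (λ i≡r → toℕ-injective (trans (iz≡ i) (trans (cong (_* P) i≡r) (sym k≡rP))))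
  term : ∀ i → (if ⌊ mulZ i z Fin.≟ k ⌋ then + f i else + 0) ≡ h (toℕ i)
  term i rewrite ⌊⌋-⇔ (hit i) (mulZ i z Fin.≟ k) (toℕ i % M ≟ r) with toℕ i % M ≟ r
  ... | yes i≡r = cong +_ (f≡v i i≡r)
  ... | no  _   = refl

firstFrom-least : ∀ fuel s {K} (P : ℕ → Bool) → s ≤ K → K < s + fuel → P K ≡ true →
  (∀ {k} → s ≤ k → k < K → P k ≡ false) → firstFrom fuel s P ≡ K
firstFrom-least zero s P s≤K K<s+0 _ _ = contradiction (subst (_ <_) (+-identityʳ s) K<s+0) (≤⇒≯ s≤K)
firstFrom-least (suc fuel) s {K} P s≤K K<s+fuel PK P<K with P s in Ps
... | true  = [ (λ s<K → contradiction (trans (sym Ps) (P<K ≤-refl s<K)) λ ()) , id ]′ (m≤n⇒m<n∨m≡n s≤K)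
... | false = firstFrom-least fuel (suc s) P s<K (subst (K <_) (+-suc s fuel) K<s+fuel) PK (P<K ∘ <⇒≤)
  where
  s<K : s < K
  s<K = ≤∧≢⇒< s≤K (λ s≡K → contradiction (trans (sym Ps) (trans (cong P s≡K) PK)) λ ())

module _ (p : ℕ) .{{_ : NonZero p}} where

  ∃-valuation : ∀ b {x} → 0 < x → x < p ^ b → ∃₂ λ v u → v < b × x ≡ p ^ v * u × ¬ (p ∣ u)
  ∃-valuation zero    {x} 0<x (s≤s x≤0) = contradiction (<-≤-trans 0<x x≤0) n≮0
  ∃-valuation (suc b) {x} 0<x x<p^1+b with p ∣? x
  ... | no  p∤x = 0 , x , s≤s z≤n , sym (*-identityˡ x) , p∤x
  ... | yes (divides c x≡cp)
    with v , u , v<b , c≡p^vu , p∤u ←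
      ∃-valuation b {c} (n≢0⇒n>0 (λ c≡0 → <⇒≢ 0<x (sym (trans x≡cp (cong (_* p) c≡0)))))
                        (*-cancelʳ-< p c (p ^ b) (subst₂ _<_ x≡cp (*-comm p (p ^ b)) x<p^1+b))
    = suc v , u , s≤s v<b , trans x≡cp (trans (cong (_* p) c≡p^vu) (xy∙z≈zx∙y (p ^ v) u p)) , p∤u

  ^-injective : 1 < p → ∀ {i j} → p ^ i ≡ p ^ j → i ≡ j
  ^-injective 1<p {i} {j} p^i≡p^j with <-cmp i j
  ... | tri< i<j _ _ = contradiction p^i≡p^j (<⇒≢ (^-monoʳ-< p 1<p i<j))
  ... | tri≈ _ i≡j _ = i≡j
  ... | tri> _ _ j<i = contradiction (sym p^i≡p^j) (<⇒≢ (^-monoʳ-< p 1<p j<i))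

  ¬p^1+v∣p^v*u : ∀ v {u} → ¬ (p ∣ u) → ¬ (p ^ suc v ∣ p ^ v * u)
  ¬p^1+v∣p^v*u v {u} p∤u p^1+v∣ =
    p∤u (*-cancelˡ-∣ (p ^ v) {{m^n≢0 p v}} (subst (_∣ p ^ v * u) (*-comm p (p ^ v)) p^1+v∣))

prime^∣m*n⇒∣m : ∀ {p} → Prime p → ∀ e {m n} → ¬ (p ∣ n) → p ^ e ∣ m * n → p ^ e ∣ m
prime^∣m*n⇒∣m p-prime zero    {m}     _   _ = 1∣ m
prime^∣m*n⇒∣m {p} p-prime (suc e) {m} {n} p∤n p^1+e∣mn
  with euclidsLemma m n p-prime (∣-trans (m∣m*n (p ^ e)) p^1+e∣mn)
... | inj₂ p∣n = contradiction p∣n p∤n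
... | inj₁ (divides c refl) =
  subst (p * p ^ e ∣_) (*-comm p c)
    (*-monoʳ-∣ p (prime^∣m*n⇒∣m p-prime e p∤n (*-cancelˡ-∣ p {{prime⇒nonZero p-prime}} p^e∣cn)))
  where
  p^e∣cn : p * p ^ e ∣ p * (c * n)
  p^e∣cn = subst (p * p ^ e ∣_) (xy∙z≈y∙xz c p n) p^1+e∣mn

ord-zero : ∀ {n} (x : Fin n) → toℕ x ≡ 0 → ord x ≡ 1
ord-zero {n} x x≡0 = firstFrom-least n 1 _ ≤-refl (s≤s (≤-<-trans z≤n (toℕ<n x)))
  (⌊⌋-true (n ∣? 1 * toℕ x) (subst (n ∣_) (sym (trans (*-identityˡ (toℕ x)) x≡0)) (n ∣0)))
  (λ 1≤k k<1 → contradiction (≤-trans k<1 1≤k) (<-irrefl refl))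

ord-valuation : ∀ {p α} → Prime p → (x : Fin (p ^ α)) → ∀ {v u} → v < α → toℕ x ≡ p ^ v * u → ¬ (p ∣ u) →
  ord x ≡ p ^ (α ∸ v)
ord-valuation {p} {α} p-prime x {v} {u} v<α x≡p^vu p∤u =
  firstFrom-least n 1 _ (m^n>0 p (α ∸ v)) (s≤s (^-monoʳ-≤ p (m∸n≤m α v)))
    (⌊⌋-true (n ∣? Q * toℕ x) (subst (n ∣_) (sym Qx≡nu) (m∣m*n u)))
    (λ {k} 1≤k k<Q → ⌊⌋-false (n ∣? k * toℕ x) (λ n∣kx → <⇒≱ k<Q (∣⇒≤ {{>-nonZero 1≤k}} (Q∣k n∣kx))))
  where
  instance
    p≢0 : NonZero p
    p≢0 = prime⇒nonZero p-prime
    p^v≢0 : NonZero (p ^ v)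
    p^v≢0 = m^n≢0 p v
  n Q : ℕ
  n = p ^ α
  Q = p ^ (α ∸ v)
  p^v*Q≡n : p ^ v * Q ≡ n
  p^v*Q≡n = trans (sym (^-distribˡ-+-* p v (α ∸ v))) (cong (p ^_) (m+[n∸m]≡n (<⇒≤ v<α)))
  kx≡ : ∀ k → k * toℕ x ≡ p ^ v * (k * u)
  kx≡ k = trans (cong (k *_) x≡p^vu) (x∙yz≈y∙xz k (p ^ v) u)
  Qx≡nu : Q * toℕ x ≡ n * u
  Qx≡nu = trans (kx≡ Q) (trans (sym (*-assoc (p ^ v) Q u)) (cong (_* u) p^v*Q≡n))
  Q∣k : ∀ {k} → n ∣ k * toℕ x → Q ∣ k
  Q∣k {k} n∣kx =
    prime^∣m*n⇒∣m p-prime (α ∸ v) p∤u (*-cancelˡ-∣ (p ^ v) (subst₂ _∣_ (sym p^v*Q≡n) (kx≡ k) n∣kx))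

module PrimePower (p : ℕ) (1<p : 1 < p) (a : ℕ) where

  α n : ℕ
  α = suc a
  n = p ^ α

  instance
    p≢0 : NonZero p
    p≢0 = >-nonZero (<-trans (s≤s z≤n) 1<p)
    p^a≢0 : NonZero (p ^ a)
    p^a≢0 = m^n≢0 p a
    n≢0 : NonZero n
    n≢0 = m^n≢0 p α

  Φ-periodic : ∀ {k₁ k₂} (j : Fin n) → toℕ k₁ % p ^ a ≡ toℕ k₂ % p ^ a →
    Φ p α (subZ k₁ j) ≡ Φ p α (subZ k₂ j)
  Φ-periodic {k₁} {k₂} j k₁≡k₂ =
    cong (λ b → if b then + 1 else + 0) (⌊⌋-⇔ (mk⇔ (%-≡⇒∣⇒∣ same) (%-≡⇒∣⇒∣ (sym same))) _ _)
    where
    shifted : ∀ k → toℕ (subZ k j) % p ^ a ≡ (toℕ k % p ^ a + (n ∸ toℕ j) % p ^ a) % p ^ a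
    shifted k = trans (cong (_% p ^ a) (toℕ-subZ k j))
                      (trans (m∣n⇒o%n%m≡o%m (p ^ a) n _ (n∣m*n p)) (%-distribˡ-+ (toℕ k) _ (p ^ a)))
    same : toℕ (subZ k₁ j) % p ^ a ≡ toℕ (subZ k₂ j) % p ^ a
    same = trans (shifted k₁) (trans (cong (λ w → (w + (n ∸ toℕ j) % p ^ a) % p ^ a) k₁≡k₂) (sym (shifted k₂)))

  -- G − c·δ₀ = g·Φ, and g·Φ inherits the period p ^ a of Φ.
  EvalEq⇒periodic : ∀ {G c} → EvalEq p α G c → ∀ {k₁ k₂} → toℕ k₁ ≢ 0 → toℕ k₂ ≢ 0 →
    toℕ k₁ % p ^ a ≡ toℕ k₂ % p ^ a → G k₁ ≡ G k₂
  EvalEq⇒periodic {G} {c} (g , G-c≡gΦ) {k₁} {k₂} k₁≢0 k₂≢0 k₁≡k₂ = begin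
    G k₁                                                ≡⟨ without-constant k₁≢0 ⟩
    G k₁ - (if ⌊ toℕ k₁ ≟ 0 ⌋ then c else + 0)          ≡⟨ G-c≡gΦ k₁ ⟩
    conv g (Φ p α) k₁                                   ≡⟨ sumℤ-cong (λ j → cong (g j *ℤ_) (Φ-periodic j k₁≡k₂)) ⟩
    conv g (Φ p α) k₂                                   ≡⟨ sym (G-c≡gΦ k₂) ⟩
    G k₂ - (if ⌊ toℕ k₂ ≟ 0 ⌋ then c else + 0)          ≡⟨ sym (without-constant k₂≢0) ⟩
    G k₂                                                ∎
    where
    open ≡-Reasoning
    without-constant : ∀ {k} → toℕ k ≢ 0 → G k ≡ G k - (if ⌊ toℕ k ≟ 0 ⌋ then c else + 0)
    without-constant {k} k≢0 =
      sym (trans (cong (λ b → G k - (if b then c else + 0)) (⌊⌋-false (toℕ k ≟ 0) k≢0)) (ℤ.+-identityʳ (G k)))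

  module SamplePoints {m : ℕ} (m≤a : m ≤ a) where

    j M : ℕ
    j = a ∸ m
    M = p ^ suc m

    instance
      p^m≢0 : NonZero (p ^ m)
      p^m≢0 = m^n≢0 p m
      p^j≢0 : NonZero (p ^ j)
      p^j≢0 = m^n≢0 p j
      M≢0 : NonZero M
      M≢0 = m^n≢0 p (suc m)
      p^m*p^j≢0 : NonZero (p ^ m * p ^ j)
      p^m*p^j≢0 = m*n≢0 (p ^ m) (p ^ j)

    p^a≡p^m*p^j : p ^ a ≡ p ^ m * p ^ j
    p^a≡p^m*p^j = trans (cong (p ^_) (sym (m+[n∸m]≡n m≤a))) (^-distribˡ-+-* p m j)

    n≡M*p^j : n ≡ M * p ^ j
    n≡M*p^j = trans (cong (p *_) p^a≡p^m*p^j) (sym (*-assoc p (p ^ m) (p ^ j)))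

    z : Fin n
    z = fromℕ< (^-monoʳ-< p 1<p (s≤s (m∸n≤m a m)))

    z≢0 : toℕ z ≢ 0
    z≢0 z≡0 = ≢-nonZero⁻¹ (p ^ j) (trans (sym (toℕ-fromℕ< _)) z≡0)

    point : Fin n → Fin n
    point x = fromℕ< (subst (toℕ x % M * p ^ j <_) (sym n≡M*p^j) (*-monoˡ-< (p ^ j) (m%n<n (toℕ x) M)))

    point≢0 : ∀ {x} → ¬ (M ∣ toℕ x) → toℕ (point x) ≢ 0
    point≢0 {x} M∤x point≡0 =
      M∤x (m%n≡0⇒n∣m (toℕ x) M (m*n≡0⇒m≡0 _ (p ^ j) (trans (sym (toℕ-fromℕ< _)) point≡0)))

    point-mod : ∀ x → toℕ (point x) % p ^ a ≡ toℕ x % p ^ m * p ^ j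
    point-mod x = trans (cong (_% p ^ a) (toℕ-fromℕ< _))
                        (trans (%-congʳ p^a≡p^m*p^j) (%-scaled (toℕ x) p (p ^ m) (p ^ j)))

  _%ₚ_ : ℕ → ℕ → ℕ
  t %ₚ k = _%_ t (p ^ k) {{m^n≢0 p k}}

  module Constancy (f : Multiset n) (integral : ∀ z → toℕ z ≢ 0 → ∃ λ c → EvalEq p α (F f z) c) where

    ResidueConstant : ℕ → Set
    ResidueConstant m = ∀ x y → toℕ x %ₚ m ≡ toℕ y %ₚ m →
      ¬ (p ^ suc m ∣ toℕ x) → ¬ (p ^ suc m ∣ toℕ y) → f x ≡ f y

    residueConstant-top : ResidueConstant α
    residueConstant-top x y x≡y _ _ =
      cong f (toℕ-injective (trans (sym (m<n⇒m%n≡m (toℕ<n x))) (trans x≡y (m<n⇒m%n≡m (toℕ<n y)))))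

    -- Compare the coefficients of F f (p ^ j) at (x mod p ^ (m + 1)) p ^ j and (y mod p ^ (m + 1)) p ^ j.
    residueConstant-step : ∀ {m} → m < α → ResidueConstant (suc m) → ResidueConstant m
    residueConstant-step {m} (s≤s m≤a) constant x y x≡y M∤x M∤y =
      *-cancelˡ-≡ (f x) (f y) (p ^ j) (ℤ.+-injective (begin
        + (p ^ j * f x)   ≡⟨ sym (F-at-point M∤x) ⟩
        F f z (point x)   ≡⟨ EvalEq⇒periodic {F f z} (proj₂ (integral z z≢0))
                                               (point≢0 M∤x) (point≢0 M∤y) points-agree ⟩
        F f z (point y)   ≡⟨ F-at-point M∤y ⟩
        + (p ^ j * f y)   ∎))
      where
      open ≡-Reasoning
      open SamplePoints m≤a
      class-constant : ∀ {x i} → ¬ (M ∣ toℕ x) → toℕ i % M ≡ toℕ x % M → f i ≡ f x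
      class-constant M∤x i≡x = constant _ _ i≡x (lift (M∤x ∘ %-≡⇒∣⇒∣ i≡x)) (lift M∤x)
        where
        lift : ∀ {t} → ¬ (M ∣ t) → ¬ (p ^ suc (suc m) ∣ t)
        lift M∤t = M∤t ∘ ∣-trans (n∣m*n p)
      F-at-point : ∀ {x} → ¬ (M ∣ toℕ x) → F f z (point x) ≡ + (p ^ j * f x)
      F-at-point {x} M∤x = F-coeff-on-class M (p ^ j) n≡M*p^j f (toℕ-fromℕ< _) (m%n<n (toℕ x) M) (toℕ-fromℕ< _)
                                            (λ _ i≡x → class-constant M∤x i≡x)
      points-agree : toℕ (point x) % p ^ a ≡ toℕ (point y) % p ^ a
      points-agree = trans (point-mod x) (trans (cong (_* p ^ j) x≡y) (sym (point-mod y)))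

    residueConstant : ∀ k {m} → k + m ≡ α → ResidueConstant m
    residueConstant zero    refl  = residueConstant-top
    residueConstant (suc k) {m} k+m≡α =
      residueConstant-step (subst (m <_) k+m≡α (s≤s (m≤n+m m k))) (residueConstant k (trans (+-suc k m) k+m≡α))

    constant-on-valuation : ∀ {v u₁ u₂} (x y : Fin n) → v < α → toℕ x ≡ p ^ v * u₁ → toℕ y ≡ p ^ v * u₂ →
      ¬ (p ∣ u₁) → ¬ (p ∣ u₂) → f x ≡ f y
    constant-on-valuation {v} {u₁} {u₂} x y v<α x≡ y≡ p∤u₁ p∤u₂ =
      residueConstant (α ∸ v) (m∸n+n≡m (<⇒≤ v<α)) x y (trans (residue-zero x≡) (sym (residue-zero y≡)))
        (subst (λ t → ¬ (p ^ suc v ∣ t)) (sym x≡) (¬p^1+v∣p^v*u p v p∤u₁))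
        (subst (λ t → ¬ (p ^ suc v ∣ t)) (sym y≡) (¬p^1+v∣p^v*u p v p∤u₂))
      where
      residue-zero : ∀ {t u} → t ≡ p ^ v * u → t %ₚ v ≡ 0
      residue-zero {t} {u} t≡ = n∣m⇒m%n≡0 t (p ^ v) {{m^n≢0 p v}} (subst (p ^ v ∣_) (sym t≡) (m∣m*n u))

module _ {N : ℕ} (x : Fin N) {s : ℕ} where

  ⨄-map-∉ : (G : ℕ → Multiset N) {rs : List ℕ} → (∀ {r} → r ≢ s → G r x ≡ 0) → s ∉ rs →
    ⨄ (map G rs) x ≡ 0
  ⨄-map-∉ G {[]}     _       _   = refl
  ⨄-map-∉ G {r ∷ rs} support s∉ =
    cong₂ _+_ (support (λ r≡s → s∉ (here (sym r≡s)))) (⨄-map-∉ G support (s∉ ∘ there))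

  ⨄-map-∈ : (G : ℕ → Multiset N) {rs : List ℕ} → (∀ {r} → r ≢ s → G r x ≡ 0) → Unique rs → s ∈ rs →
    ⨄ (map G rs) x ≡ G s x
  ⨄-map-∈ G support (r≢rs ∷ _) (here refl) =
    trans (cong (_+_ (G s x)) (⨄-map-∉ G support (All.All¬⇒¬Any r≢rs))) (+-identityʳ _)
  ⨄-map-∈ G support (r≢rs ∷ unique) (there s∈) =
    cong₂ _+_ (support (All.lookup r≢rs s∈)) (⨄-map-∈ G support unique s∈)

  ⨄-map-filterᵇ : (G : ℕ → Multiset N) (P : ℕ → Bool) {rs : List ℕ} → (∀ {r} → r ≢ s → G r x ≡ 0) →
    Unique rs → s ∈ rs → ⨄ (map G (filterᵇ P rs)) x ≡ (if P s then G s x else 0)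
  ⨄-map-filterᵇ G P {rs} support unique s∈ with P s in Ps
  ... | true  = ⨄-map-∈ G {filterᵇ P rs} support (Unique.filter⁺ (T? ∘ P) unique)
                        (∈-filter⁺ (T? ∘ P) s∈ (subst T (sym Ps) tt))
  ... | false = ⨄-map-∉ G {filterᵇ P rs} support (λ s∈P → subst T Ps (proj₂ (∈-filter⁻ (T? ∘ P) {xs = rs} s∈P)))

  ⋃-map-∉ : (B : ℕ → SetZ N) {rs : List ℕ} → (∀ {r} → r ≢ s → B r x ≡ false) → s ∉ rs →
    ⋃ (map B rs) x ≡ false
  ⋃-map-∉ B {[]}     _       _   = refl
  ⋃-map-∉ B {r ∷ rs} support s∉ =
    cong₂ _∨_ (support (λ r≡s → s∉ (here (sym r≡s)))) (⋃-map-∉ B support (s∉ ∘ there))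

  ⋃-map-∈ : (B : ℕ → SetZ N) {rs : List ℕ} → B s x ≡ true → s ∈ rs → ⋃ (map B rs) x ≡ true
  ⋃-map-∈ B {_ ∷ rs} Bs (here refl) = cong (_∨ ⋃ (map B rs) x) Bs
  ⋃-map-∈ B {r ∷ rs} Bs (there s∈) = trans (cong (B r x ∨_) (⋃-map-∈ B Bs s∈)) (∨-zeroʳ (B r x))

  ⋃-map-filterᵇ : (B : ℕ → SetZ N) (P : ℕ → Bool) {rs : List ℕ} → (∀ {r} → r ≢ s → B r x ≡ false) →
    B s x ≡ true → s ∈ rs → ⋃ (map B (filterᵇ P rs)) x ≡ P s
  ⋃-map-filterᵇ B P {rs} support Bs s∈ with P s in Ps
  ... | true  = ⋃-map-∈ B {filterᵇ P rs} Bs (∈-filter⁺ (T? ∘ P) s∈ (subst T (sym Ps) tt))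
  ... | false = ⋃-map-∉ B {filterᵇ P rs} support (λ s∈P → subst T Ps (proj₂ (∈-filter⁻ (T? ∘ P) {xs = rs} s∈P)))

U-split : ∀ {N} (X : SetZ N) x → U X x ≡ (if U X x ≡ᵇ 2 then 2 else 0) + (if U X x ≡ᵇ 1 then 1 else 0)
U-split X x with X x | X (negZ x)
... | true  | true  = refl
... | true  | false = refl
... | false | true  = refl
... | false | false = refl

module Decomposition (p : ℕ) (p-prime : Prime p) (a : ℕ) (X : SetZ (p ^ suc a))
  (X0 : ∀ i → toℕ i ≡ 0 → X i ≡ false)
  (integral : ∀ z → toℕ z ≢ 0 → ∃ λ c → EvalEq p (suc a) (F (U X) z) c) where

  1<p : 1 < p
  1<p = nonTrivial⇒n>1 p {{prime⇒nonTrivial p-prime}}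

  open PrimePower p 1<p a
  open Constancy (U X) integral

  levels : List ℕ
  levels = applyUpTo suc α

  ∈-levels : ∀ {s} → 1 ≤ s → s ≤ α → s ∈ levels
  ∈-levels {suc t} _ t<α = ∈-applyUpTo⁺ suc t<α

  levels-sorted : Linked _<_ levels
  levels-sorted = Linked.applyUpTo⁺₂ suc α (λ i → n<1+n (suc i))

  levels-unique : Unique levels
  levels-unique = AllPairs.map <⇒≢ (Linked.Linked⇒AllPairs <-trans levels-sorted)

  filter-sorted : ∀ P → Linked _<_ (filterᵇ P levels)
  filter-sorted P = Linked.filter⁺ (T? ∘ P) <-trans levels-sorted

  filter-bounded : ∀ P → All (λ r → 1 ≤ r × r ≤ α) (filterᵇ P levels)
  filter-bounded P = All.filter⁺ (T? ∘ P) (All.applyUpTo⁺₁ suc α (λ i<α → s≤s z≤n , i<α))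

  orbit-rep : ℕ → Fin n
  orbit-rep s = (p ^ (α ∸ s)) mod n

  multiplicity : ℕ → ℕ
  multiplicity s = U X (orbit-rep s)

  has-multiplicity : ℕ → ℕ → Bool
  has-multiplicity k r = multiplicity r ≡ᵇ k

  R₁ R₂ : List ℕ
  R₁ = filterᵇ (has-multiplicity 2) levels
  R₂ = filterᵇ (has-multiplicity 1) levels

  U-on-valuation : ∀ x {v u} → v < α → toℕ x ≡ p ^ v * u → ¬ (p ∣ u) → U X x ≡ multiplicity (α ∸ v)
  U-on-valuation x {v} v<α x≡ p∤u = constant-on-valuation x (orbit-rep (α ∸ v)) v<α x≡ rep≡ p∤u p∤1
    where
    rep≡ : toℕ (orbit-rep (α ∸ v)) ≡ p ^ v * 1
    rep≡ = trans (toℕ-fromℕ< _) (trans (cong (λ e → p ^ e % n) (m∸[m∸n]≡n (<⇒≤ v<α)))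
                 (trans (m<n⇒m%n≡m (^-monoʳ-< p 1<p v<α)) (sym (*-identityʳ _))))
    p∤1 : ¬ (p ∣ 1)
    p∤1 p∣1 = <⇒≢ 1<p (sym (∣1⇒≡1 p∣1))

  orbit : ∀ x → toℕ x ≢ 0 → ∃ λ s → 1 ≤ s × s ≤ α × ord x ≡ p ^ s × U X x ≡ multiplicity s
  orbit x x≢0 with v , u , v<α , x≡ , p∤u ← ∃-valuation p α (n≢0⇒n>0 x≢0) (toℕ<n x) =
    α ∸ v , m<n⇒0<n∸m v<α , m∸n≤m α v , ord-valuation p-prime x v<α x≡ p∤u , U-on-valuation x v<α x≡ p∤u

  U-zero : ∀ {x} → toℕ x ≡ 0 → U X x ≡ 0
  U-zero {x} x≡0 = cong₂ (λ b c → (if b then 1 else 0) + (if c then 1 else 0)) (X0 x x≡0) (X0 (negZ x) -x≡0)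
    where
    -x≡0 : toℕ (negZ x) ≡ 0
    -x≡0 = trans (toℕ-negZ x) (trans (cong (λ t → (n ∸ t) % n) x≡0) (n%n≡0 n))

  O-ord : ∀ {x s} → ord x ≡ p ^ s → ∀ r → O p α r x ≡ ⌊ r ≟ s ⌋
  O-ord ord≡ r =
    ⌊⌋-⇔ (mk⇔ (λ e → ^-injective p 1<p (trans (sym e) ord≡)) (λ r≡s → trans ord≡ (cong (p ^_) (sym r≡s)))) _ _

  O-support : ∀ {x s} → ord x ≡ p ^ s → ∀ {r} → r ≢ s → O p α r x ≡ false
  O-support {s = s} ord≡ {r} r≢s = trans (O-ord ord≡ r) (⌊⌋-false (r ≟ s) r≢s)

  twice-O-support : ∀ {x s} → ord x ≡ p ^ s → ∀ {r} → r ≢ s → (2⊗ Δ (O p α r)) x ≡ 0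
  twice-O-support ord≡ r≢s = cong (λ b → 2 * (if b then 1 else 0)) (O-support ord≡ r≢s)

  U-decomposition : ∀ x → U X x ≡ (⨄ (map (λ r → 2⊗ Δ (O p α r)) R₁) ⊎ₘ Δ (⋃ (map (O p α) R₂))) x
  U-decomposition x with toℕ x ≟ 0
  ... | yes x≡0 = trans (U-zero x≡0) (sym (cong₂ _+_
          (⨄-map-∉ x (λ r → 2⊗ Δ (O p α r)) (twice-O-support ord≡1) (0∉ (filter-bounded (has-multiplicity 2))))
          (cong (λ b → if b then 1 else 0)
                (⋃-map-∉ x (O p α) (O-support ord≡1) (0∉ (filter-bounded (has-multiplicity 1)))))))
    where
    ord≡1 : ord x ≡ p ^ 0
    ord≡1 = ord-zero x x≡0
    0∉ : ∀ {rs} → All (λ r → 1 ≤ r × r ≤ α) rs → 0 ∉ rs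
    0∉ bounded 0∈ with () ← proj₁ (All.lookup bounded 0∈)
  ... | no x≢0 with s , 1≤s , s≤α , ord≡ , U≡ ← orbit x x≢0 = begin
    U X x                                                                           ≡⟨ U≡ ⟩
    multiplicity s                                                                  ≡⟨ U-split X (orbit-rep s) ⟩
    (if multiplicity s ≡ᵇ 2 then 2 else 0) + (if multiplicity s ≡ᵇ 1 then 1 else 0) ≡⟨ cong₂ _+_ twice once ⟩
    (⨄ (map (λ r → 2⊗ Δ (O p α r)) R₁) ⊎ₘ Δ (⋃ (map (O p α) R₂))) x               ∎
    where
    open ≡-Reasoning
    s∈ : s ∈ levels
    s∈ = ∈-levels 1≤s s≤α
    O-self : O p α s x ≡ true
    O-self = trans (O-ord ord≡ s) (⌊⌋-true (s ≟ s) refl)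
    twice : (if multiplicity s ≡ᵇ 2 then 2 else 0) ≡ ⨄ (map (λ r → 2⊗ Δ (O p α r)) R₁) x
    twice = sym (trans (⨄-map-filterᵇ x (λ r → 2⊗ Δ (O p α r)) (has-multiplicity 2)
                                      (twice-O-support ord≡) levels-unique s∈)
                       (cong (λ b → if multiplicity s ≡ᵇ 2 then 2 * (if b then 1 else 0) else 0) O-self))
    once : (if multiplicity s ≡ᵇ 1 then 1 else 0) ≡ Δ (⋃ (map (O p α) R₂)) x
    once = sym (cong (λ b → if b then 1 else 0)
                     (⋃-map-filterᵇ x (O p α) (has-multiplicity 1) (O-support ord≡) O-self s∈))

lemma3p1 : (p α : ℕ) → Prime p → 1 ≤ α → (X : SetZ (p ^ α)) →
    (∀ (i : Fin (p ^ α)) → toℕ i ≡ 0 → X i ≡ false) →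
    X ≢ negSet X →
    (∃₂ λ (m : ℕ) (_ : 1 ≤ m) → ∀ (z : Fin (p ^ α)) → toℕ z ≢ 0 →
       EvalEq p α (F (U X) z) (+ 0) ⊎ EvalEq p α (F (U X) z) (- (+ m))) →
    ∃₂ λ (R₁ R₂ : List ℕ) →
      Linked _<_ R₁ × All (λ r → 1 ≤ r × r ≤ α) R₁ ×
      Linked _<_ R₂ × All (λ r → 1 ≤ r × r ≤ α) R₂ ×
      (∀ (x : Fin (p ^ α)) →
        U X x ≡ (⨄ (map (λ r → 2⊗ Δ (O p α r)) R₁) ⊎ₘ Δ (⋃ (map (O p α) R₂))) x)
lemma3p1 p zero    _       ()
lemma3p1 p (suc a) p-prime _ X X0 _ (m , _ , transform) =
  R₁ , R₂ , filter-sorted (has-multiplicity 2) , filter-bounded (has-multiplicity 2) ,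
  filter-sorted (has-multiplicity 1) , filter-bounded (has-multiplicity 1) , U-decomposition
  where
  open Decomposition p p-prime a X X0 (λ z z≢0 → [ (+ 0 ,_) , (- (+ m) ,_) ]′ (transform z z≢0))
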